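{- Let $G$ and $H$ be finite non-bipartite graphs with $\chi(G)=\chi(H)-j$ for some integer $j\ge 0$, and let $i$ be an integer with $i+j\geq -\chi(G)+3$. If $G\longrightarrow H$, then $\theta_{i+j}(G)\geq \theta_i(H)$.
   Context: $G\longrightarrow H$ means there is a homomorphism (adjacency-preserving vertex map) from $G$ to $H$. $og(G)$ is the odd girth. For a positive integer $k$, $G^{k}$ has vertex set $V(G)$, with $u,v$ adjacent iff there is a walk of length $k$ between them in $G$. $S_t(G)$ replaces each edge by a path with exactly $t-1$ inner vertices, and for non-negative integers $r,s$, $G^{\frac{2r+1}{2s+1}}:=(S_{2s+1}(G))^{2r+1}$. For a non-bipartite graph $G$ and an integer $i\ge -\chi(G)+3$, the $i$th power thickness is $\theta_i(G):=\sup\{\frac{2r+1}{2s+1} : r,s\ge 0 \text{ integers},\ \chi(G^{\frac{2r+1}{2s+1}})\le \chi(G)+i,\ \frac{2r+1}{2s+1}<og(G)\}$. -}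

module Defs where

open import Data.Bool using (Bool; true; false; T)
open import Data.Nat using (ℕ; zero; suc; _+_; _*_; _∸_; _<_; _≤_; _<?_)
open import Data.Fin as Fin using (Fin; fromℕ<)
open import Data.Integer as ℤ using (ℤ; +_)
open import Data.Rational as ℚ using (ℚ)
open import Data.Product using (Σ; _×_; _,_; ∃)
open import Data.Sum using (_⊎_; inj₁; inj₂)
open import Relation.Nullary using (¬_; yes; no)
open import Relation.Binary.PropositionalEquality using (_≡_; _≢_)
open import Function.Definitions using (Injective)

record SimpleGraph : Set where
  field
    n      : ℕ
    adj    : Fin n → Fin n → Bool
    sym    : ∀ u v → adj u v ≡ adj v u
    irrefl : ∀ v → adj v v ≡ false

open SimpleGraph public

-- General graphs (possibly with loops), used for subdivisions and powers.
record Graph : Set₁ where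
  field
    V   : Set
    Adj : V → V → Set

open Graph public

underlying : SimpleGraph → Graph
underlying G = record { V = Fin (n G) ; Adj = λ u v → T (adj G u v) }

_⟶_ : SimpleGraph → SimpleGraph → Set
G ⟶ H = Σ (Fin (n G) → Fin (n H)) λ f →
          ∀ u v → T (adj G u v) → T (adj H (f u) (f v))

-- proper k-colouring (a graph with a loop has none)
Colorable : Graph → ℕ → Set
Colorable X k = Σ (V X → Fin k) λ c → ∀ x y → Adj X x y → c x ≢ c y

ColorableZ : Graph → ℤ → Set
ColorableZ X k = Σ ℕ λ m → (+ m ≡ k) × Colorable X m

IsChromaticNumber : SimpleGraph → ℕ → Set
IsChromaticNumber G k =
  Colorable (underlying G) k × (∀ m → Colorable (underlying G) m → k ≤ m)

Bipartite : SimpleGraph → Set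
Bipartite G = Colorable (underlying G) 2

CycleOfLength : SimpleGraph → ℕ → Set
CycleOfLength G k = Σ ℕ λ t → (k ≡ 3 + t) ×
  Σ (Fin (3 + t) → Fin (n G)) λ c → Injective _≡_ _≡_ c ×
    ((∀ (i : Fin (2 + t)) → T (adj G (c (Fin.inject₁ i)) (c (Fin.suc i)))) ×
     T (adj G (c (Fin.fromℕ (2 + t))) (c Fin.zero)))

Odd : ℕ → Set
Odd k = Σ ℕ λ m → k ≡ suc (2 * m)

IsOddGirth : SimpleGraph → ℕ → Set
IsOddGirth G g = (Odd g × CycleOfLength G g) ×
  (∀ k → Odd k → CycleOfLength G k → g ≤ k)

-- Subdivision S_t(G): each edge replaced by a path with t - 1 inner vertices.

-- edges, each listed once (oriented from smaller to larger endpoint)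
Edge : SimpleGraph → Set
Edge G = Σ (Fin (n G)) λ u → Σ (Fin (n G)) λ v → (u Fin.< v) × T (adj G u v)

SubV : ℕ → SimpleGraph → Set
SubV t G = Fin (n G) ⊎ (Edge G × Fin (t ∸ 1))

-- the m-th vertex of the path replacing edge e = uv (0 ↦ u, t ↦ v)
pathVertex : (t : ℕ) (G : SimpleGraph) → Edge G → ℕ → SubV t G
pathVertex t G (u , v , _) zero = inj₁ u
pathVertex t G e@(u , v , _) (suc m) with m <? t ∸ 1
... | yes p = inj₂ (e , fromℕ< p)
... | no _  = inj₁ v

SubAdj : (t : ℕ) (G : SimpleGraph) → SubV t G → SubV t G → Set
SubAdj t G x y = Σ (Edge G) λ e → Σ ℕ λ m → m < t ×
  ((pathVertex t G e m ≡ x × pathVertex t G e (suc m) ≡ y) ⊎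
   (pathVertex t G e m ≡ y × pathVertex t G e (suc m) ≡ x))

S : ℕ → SimpleGraph → Graph
S t G = record { V = SubV t G ; Adj = SubAdj t G }

data Walk (X : Graph) : V X → V X → ℕ → Set where
  [] : ∀ {x} → Walk X x x zero
  _∷_ : ∀ {x y z k} → Adj X x z → Walk X z y k → Walk X x y (suc k)

Pow : Graph → ℕ → Graph
Pow X k = record { V = V X ; Adj = λ x y → Walk X x y k }

FracPow : SimpleGraph → ℕ → ℕ → Graph
FracPow G r s = Pow (S (suc (2 * s)) G) (suc (2 * r))

frac : ℕ → ℕ → ℚ
frac r s = ℚ._/_ (+ suc (2 * r)) (suc (2 * s))

-- Power thickness θ_i(G) = sup of the set below (G non-bipartite,
-- χ(G) = c, og(G) = g, i ≥ -c + 3).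

InThicknessSet : SimpleGraph → (c g : ℕ) → ℤ → ℕ → ℕ → Set
InThicknessSet G c g i r s =
  ColorableZ (FracPow G r s) (+ c ℤ.+ i) ×
  suc (2 * r) < g * suc (2 * s)

-- sup A ≥ sup B for subsets A, B of ℚ (sups taken in ℝ ∪ {-∞}):
-- every rational strictly below an element of B is strictly below
-- an element of A.
SupGeq : (ℕ → ℕ → Set) → (ℕ → ℕ → Set) → Set
SupGeq A B = ∀ r s → B r s → ∀ (q : ℚ) → q ℚ.< frac r s →
  Σ ℕ λ r' → Σ ℕ λ s' → A r' s' × q ℚ.< frac r' s'

-- A homomorphism f : G → H subdivides to S_t(G) → S_t(H): the path replacing uv is sent onto
-- the path replacing f(u)f(v), traversed from f(u) to f(v). Hence it induces
-- G^{(2r+1)/(2s+1)} → H^{(2r+1)/(2s+1)}, and every colouring of H's power with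
-- χ(H) + i = χ(G) + (i + j) colours pulls back to G's power. The bound
-- (2r+1)/(2s+1) < og(G) then comes for free: an odd cycle of length g in G yields a closed
-- walk of odd length g(2s+1) in S_{2s+1}(G), which back-and-forth steps pad to any larger odd
-- length; so if g(2s+1) ≤ 2r+1 the power has a loop and cannot be coloured. Thus every
-- element of the set defining θ_i(H) lies in the set defining θ_{i+j}(G).
module Submission where

open import Defs hiding (sym)
open import Data.Nat using (ℕ; _+_)
open import Data.Integer using (ℤ; +_; -_; _≤_)
open import Relation.Nullary using (¬_)
open import Relation.Binary.PropositionalEquality using (_≡_)

open import Data.Nat as ℕ using (zero; suc; _*_; _∸_; _<_; _<?_; _≤?_; _≤′_; ≤′-refl; ≤′-step; s≤s)
import Data.Nat.Properties as ℕ
open import Data.Nat.Tactic.RingSolver using (solve-∀)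
open import Data.Fin as Fin using (Fin; toℕ)
import Data.Fin.Properties as Fin
import Data.Integer as ℤ
import Data.Integer.Properties as ℤ
open import Data.Bool using (T)
open import Data.Empty using (⊥-elim)
open import Data.Product using (Σ; _,_)
open import Data.Sum using (inj₁; inj₂)
open import Function using (_∘_)
open import Relation.Nullary using (yes; no)
open import Relation.Binary.Definitions using (tri<; tri≈; tri>)
open import Relation.Binary.PropositionalEquality
  using (refl; sym; trans; cong; subst; subst₂; module ≡-Reasoning)

module _ {X : Graph} where

  _▷_ : ∀ {x y z k} → Walk X x y k → Adj X y z → Walk X x z (suc k)
  [] ▷ a = a ∷ []
  (b ∷ w) ▷ a = b ∷ (w ▷ a)

  _++_ : ∀ {x y z k l} → Walk X x y k → Walk X y z l → Walk X x z (k + l)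
  [] ++ w = w
  (a ∷ v) ++ w = a ∷ (v ++ w)

  module _ (Adj-sym : ∀ {x y} → Adj X x y → Adj X y x) where

    bounce : ∀ {x y k} → Walk X x y (suc k) → Walk X x y (3 + k)
    bounce w@(a ∷ _) = a ∷ (Adj-sym a ∷ w)

    -- k * 2 rather than 2 * k, so that suc k * 2 reduces to 2 + k * 2
    extend : ∀ {x y k l} → k ≤′ l → Walk X x y (suc (k * 2)) → Walk X x y (suc (l * 2))
    extend ≤′-refl w = w
    extend (≤′-step k≤l) w = bounce (extend k≤l w)

    extendOdd : ∀ {x y k l} → Odd k → Odd l → k ℕ.≤ l → Walk X x y k → Walk X x y l
    extendOdd {x} {y} (a , refl) (b , refl) k≤l =
      subst (Walk X x y) (cong suc (ℕ.*-comm b 2))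
      ∘ extend {k = a} {l = b} (ℕ.≤⇒≤′ (ℕ.*-cancelˡ-≤ 2 (ℕ.s≤s⁻¹ k≤l)))
      ∘ subst (Walk X x y) (cong suc (ℕ.*-comm 2 a))

odd-* : ∀ {a b} → Odd a → Odd b → Odd (a * b)
odd-* (m , refl) (n , refl) = n + m * suc (2 * n) , lemma m n
  where
  lemma : ∀ m n → suc (2 * m) * suc (2 * n) ≡ suc (2 * (n + m * suc (2 * n)))
  lemma = solve-∀

GraphHom : Graph → Graph → Set
GraphHom X Y = Σ (V X → V Y) λ φ → ∀ {x y} → Adj X x y → Adj Y (φ x) (φ y)

Pow-hom : ∀ {X Y} k → GraphHom X Y → GraphHom (Pow X k) (Pow Y k)
Pow-hom {X} {Y} k (φ , hom) = φ , map
  where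
  map : ∀ {x y k} → Walk X x y k → Walk Y (φ x) (φ y) k
  map [] = []
  map (a ∷ w) = hom a ∷ map w

Colorable-pullback : ∀ {X Y m} → GraphHom X Y → Colorable Y m → Colorable X m
Colorable-pullback (φ , hom) (c , proper) = c ∘ φ , λ x y a → proper (φ x) (φ y) (hom a)

loop⇒¬Colorable : ∀ {X m x} → Adj X x x → ¬ Colorable X m
loop⇒¬Colorable {x = x} a (c , proper) = proper x x a refl

adj-irrefl : ∀ G {a} → ¬ T (adj G a a)
adj-irrefl G {a} = subst T (irrefl G a)

adj-sym : ∀ G {a b} → T (adj G a b) → T (adj G b a)
adj-sym G {a} {b} = subst T (SimpleGraph.sym G a b)

SubAdj-sym : ∀ {t G x y} → SubAdj t G x y → SubAdj t G y x
SubAdj-sym (e , m , m<t , inj₁ ends) = e , m , m<t , inj₂ ends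
SubAdj-sym (e , m , m<t , inj₂ ends) = e , m , m<t , inj₁ ends

pathVertex-adj : ∀ {t} G e {m} → m < t → SubAdj t G (pathVertex t G e m) (pathVertex t G e (suc m))
pathVertex-adj G e {m} m<t = e , m , m<t , inj₁ (refl , refl)

pathVertex-last : ∀ t' G {u v} (u<v : u Fin.< v) (h : T (adj G u v))
  → pathVertex (suc t') G (u , v , u<v , h) (suc t') ≡ inj₁ v
pathVertex-last t' G _ _ with t' <? t'
... | yes t'<t' = ⊥-elim (ℕ.<-irrefl refl t'<t')
... | no _ = refl

-- the path replacing the edge ab, traversed from a to b (Edge G stores it from its smaller end)
pathBetween : ∀ t' G (a b : Fin (n G)) → T (adj G a b) → ℕ → SubV (suc t') G
pathBetween t' G a b h m with Fin.<-cmp a b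
... | tri< a<b _ _ = pathVertex (suc t') G (a , b , a<b , h) m
... | tri≈ _ refl _ = ⊥-elim (adj-irrefl G h)
... | tri> _ _ b<a = pathVertex (suc t') G (b , a , b<a , adj-sym G h) (suc t' ∸ m)

module _ (t' : ℕ) (G : SimpleGraph) {a b : Fin (n G)} (h : T (adj G a b)) where

  pathBetween-zero : pathBetween t' G a b h 0 ≡ inj₁ a
  pathBetween-zero with Fin.<-cmp a b
  ... | tri< _ _ _ = refl
  ... | tri≈ _ refl _ = ⊥-elim (adj-irrefl G h)
  ... | tri> _ _ b<a = pathVertex-last t' G b<a _

  pathBetween-last : pathBetween t' G a b h (suc t') ≡ inj₁ b
  pathBetween-last with Fin.<-cmp a b
  ... | tri< a<b _ _ = pathVertex-last t' G a<b h
  ... | tri≈ _ refl _ = ⊥-elim (adj-irrefl G h)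
  ... | tri> _ _ b<a = cong (pathVertex (suc t') G (b , a , b<a , adj-sym G h)) (ℕ.n∸n≡0 t')

  pathBetween-adj : ∀ {m} → m < suc t'
    → SubAdj (suc t') G (pathBetween t' G a b h m) (pathBetween t' G a b h (suc m))
  pathBetween-adj {m} m<t with Fin.<-cmp a b
  ... | tri< a<b _ _ = pathVertex-adj G _ m<t
  ... | tri≈ _ refl _ = ⊥-elim (adj-irrefl G h)
  ... | tri> _ _ b<a rewrite ℕ.+-∸-assoc 1 (ℕ.s≤s⁻¹ m<t) =
    SubAdj-sym (pathVertex-adj G _ (s≤s (ℕ.m∸n≤m t' m)))

  pathBetween-walk : ∀ m → m ℕ.≤ suc t'
    → Walk (S (suc t') G) (pathBetween t' G a b h 0) (pathBetween t' G a b h m) m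
  pathBetween-walk zero _ = []
  pathBetween-walk (suc m) m<t = pathBetween-walk m (ℕ.<⇒≤ m<t) ▷ pathBetween-adj {m} m<t

  edgeWalk : Walk (S (suc t') G) (inj₁ a) (inj₁ b) (suc t')
  edgeWalk = subst₂ (λ x y → Walk (S (suc t') G) x y (suc t'))
    pathBetween-zero pathBetween-last (pathBetween-walk (suc t') ℕ.≤-refl)

pathWalk : ∀ t' G M (c : Fin (suc M) → Fin (n G))
  → (∀ i → T (adj G (c (Fin.inject₁ i)) (c (Fin.suc i))))
  → Walk (S (suc t') G) (inj₁ (c Fin.zero)) (inj₁ (c (Fin.fromℕ M))) (M * suc t')
pathWalk t' G zero c steps = []
pathWalk t' G (suc M) c steps =
  edgeWalk t' G (steps Fin.zero) ++ pathWalk t' G M (c ∘ Fin.suc) (steps ∘ Fin.suc)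

cycle⇒closedWalk : ∀ t' G {g} → CycleOfLength G g
  → Σ (SubV (suc t') G) λ x → Walk (S (suc t') G) x x (g * suc t')
cycle⇒closedWalk t' G (k , refl , c , _ , steps , closing) =
  inj₁ (c (Fin.fromℕ (2 + k))) , edgeWalk t' G closing ++ pathWalk t' G (2 + k) c steps

S-hom : ∀ t' {G H} → G ⟶ H → GraphHom (S (suc t') G) (S (suc t') H)
S-hom t' {G} {H} (f , hom) = φ , φ-adj
  where
  φ : SubV (suc t') G → SubV (suc t') H
  φ (inj₁ u) = inj₁ (f u)
  φ (inj₂ ((u , v , _ , h) , k)) = pathBetween t' H (f u) (f v) (hom u v h) (suc (toℕ k))

  φ-pathVertex : ∀ u v u<v h m → m ℕ.≤ suc t'
    → φ (pathVertex (suc t') G (u , v , u<v , h) m) ≡ pathBetween t' H (f u) (f v) (hom u v h) m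
  φ-pathVertex u v u<v h zero _ = sym (pathBetween-zero t' H (hom u v h))
  φ-pathVertex u v u<v h (suc m) m<t with m <? t'
  ... | yes m<t' = cong (pathBetween t' H (f u) (f v) (hom u v h) ∘ suc) (Fin.toℕ-fromℕ< m<t')
  ... | no m≮t' rewrite ℕ.≤-antisym (ℕ.s≤s⁻¹ m<t) (ℕ.≮⇒≥ m≮t') =
    sym (pathBetween-last t' H (hom u v h))

  φ-adj : ∀ {x y} → SubAdj (suc t') G x y → SubAdj (suc t') H (φ x) (φ y)
  φ-adj ((u , v , u<v , h) , m , m<t , inj₁ (refl , refl)) =
    subst₂ (SubAdj (suc t') H)
      (sym (φ-pathVertex u v u<v h m (ℕ.<⇒≤ m<t))) (sym (φ-pathVertex u v u<v h (suc m) m<t))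
      (pathBetween-adj t' H (hom u v h) m<t)
  φ-adj ((u , v , u<v , h) , m , m<t , inj₂ (refl , refl)) =
    SubAdj-sym (φ-adj ((u , v , u<v , h) , m , m<t , inj₁ (refl , refl)))

Colorable-FracPow⇒< : ∀ G r s {g m} → Odd g → CycleOfLength G g → Colorable (FracPow G r s) m
  → suc (2 * r) < g * suc (2 * s)
Colorable-FracPow⇒< G r s {g} g-odd cycle col with g * suc (2 * s) ≤? suc (2 * r)
... | no g[2s+1]≰2r+1 = ℕ.≰⇒> g[2s+1]≰2r+1
... | yes g[2s+1]≤2r+1 with cycle⇒closedWalk (2 * s) G cycle
...   | x , closed = ⊥-elim (loop⇒¬Colorable loop col)
  where
  loop : Adj (FracPow G r s) x x
  loop = extendOdd SubAdj-sym (odd-* g-odd (s , refl)) (r , refl) g[2s+1]≤2r+1 closed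

lemma3p2 : (G H : SimpleGraph) (cG cH gG gH j : ℕ) (i : ℤ)
    → ¬ Bipartite G → ¬ Bipartite H
    → IsChromaticNumber G cG → IsChromaticNumber H cH
    → IsOddGirth G gG → IsOddGirth H gH
    → cG + j ≡ cH
    → - (+ cG) Data.Integer.+ + 3 ≤ i Data.Integer.+ + j
    → G ⟶ H
    → SupGeq (InThicknessSet G cG gG (i Data.Integer.+ + j)) (InThicknessSet H cH gH i)
lemma3p2 G H cG cH gG gH j i _ _ _ _ ((gG-odd , cycle) , _) _ cG+j≡cH _ f
         r s ((m , m≡cH+i , colH) , _) q q<r/s =
  r , s , ((m , trans m≡cH+i colour-budget , colG) , Colorable-FracPow⇒< G r s gG-odd cycle colG) , q<r/s
  where
  colG : Colorable (FracPow G r s) m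
  colG = Colorable-pullback (Pow-hom (suc (2 * r)) (S-hom (2 * s) f)) colH

  colour-budget : + cH ℤ.+ i ≡ + cG ℤ.+ (i ℤ.+ + j)
  colour-budget = begin
    + cH ℤ.+ i             ≡⟨ cong (λ c → + c ℤ.+ i) (sym cG+j≡cH) ⟩
    + (cG + j) ℤ.+ i       ≡⟨ cong (ℤ._+ i) (ℤ.pos-+ cG j) ⟩
    + cG ℤ.+ + j ℤ.+ i     ≡⟨ ℤ.+-assoc (+ cG) (+ j) i ⟩
    + cG ℤ.+ (+ j ℤ.+ i)   ≡⟨ cong (ℤ._+_ (+ cG)) (ℤ.+-comm (+ j) i) ⟩
    + cG ℤ.+ (i ℤ.+ + j)   ∎
    where open ≡-Reasoning
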